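{- Let $\tau$ be a finite vocabulary of relation and constant symbols containing equality, let $\mathcal{A}$ be a finite $\tau$-structure, and let $\mathbb{X}\colon X\to\mathbb{R}_{\geq 0}$ be a nonempty probabilistic team of $\mathcal{A}$ over a finite set $D$ of variables. Then for every formula $\phi$ of $\mathrm{FOPT}(\leq^\delta,\perp\!\!\!\perp^\delta_{\mathrm{c}})[\tau]$ whose free variables lie in $D$, \[ \mathcal{A}\models_{\mathrm{distr}(\mathbb{X})}\phi\iff \mathcal{A}\models_{\mathbb{X}}\phi . \]
   Context: Structures are finite. For a finite set $D$ of variables, $X$ denotes the set of all assignments $s\colon D\to A$. A probabilistic team over $D$ is a function $\mathbb{X}\colon X\to\mathbb{R}_{\geq 0}$; $\mathrm{supp}(\mathbb{X})=\{s\in X\mid \mathbb{X}(s)\neq 0\}$, and $\mathbb{X}$ is nonempty if its support is nonempty. For nonempty $\mathbb{X}$, $\mathrm{distr}(\mathbb{X})(s)=\mathbb{X}(s)/\sum_{t\in X}\mathbb{X}(t)$. For $a\in A$ and a variable $x$, $\mathbb{X}(a/x)$ is the probabilistic team over $D\cup\{x\}$ given by $\mathbb{X}(a/x)(s)=\sum_{t\in X,\ t(a/x)=s}\mathbb{X}(t)$, where $t(a/x)$ is $t$ modified (or extended) to send $x$ to $a$. Quantifier-free formulas $\delta$ are given by $\delta::=\lambda\mid\neg\delta\mid\delta\wedge\delta$ with $\lambda$ a first-order atomic $\tau$-formula; $\mathcal{A}\models_s\delta$ is ordinary Tarskian satisfaction. Write $\mathbb{X}[\delta]=\sum_{s\in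 X,\ \mathcal{A}\models_s\delta}\mathbb{X}(s)$. Syntax of $\mathrm{FOPT}(\leq^\delta,\perp\!\!\!\perp^\delta_{\mathrm{c}})$: $\phi::=\delta\mid \delta\leq\delta\mid \delta\perp\!\!\!\perp_{\delta}\delta\mid \dot\sim\phi\mid\phi\wedge\phi\mid\phi\mathbin{\dot\vee}\phi\mid\exists^1x\phi\mid\forall^1x\phi$. Semantics (formulas are evaluated on teams whose domain contains their free variables): $\mathcal{A}\models_{\mathbb{X}}\delta$ iff $\mathcal{A}\models_s\delta$ for all $s\in\mathrm{supp}(\mathbb{X})$; $\mathcal{A}\models_{\mathbb{X}}\delta_0\leq\delta_1$ iff $\mathbb{X}[\delta_0]\leq\mathbb{X}[\delta_1]$; $\mathcal{A}\models_{\mathbb{X}}\delta_1\perp\!\!\!\perp_{\delta_0}\delta_2$ iff $\mathbb{X}[\delta_0\wedge\delta_1]\cdot\mathbb{X}[\delta_0\wedge\delta_2]=\mathbb{X}[\delta_0]\cdot\mathbb{X}[\delta_0\wedge\delta_1\wedge\delta_2]$; $\mathcal{A}\models_{\mathbb{X}}\dot\sim\phi$ iff $\mathcal{A}\not\models_{\mathbb{X}}\phi$ or $\mathrm{supp}(\mathbb{X})=\varnothing$; $\wedge$ is conjunction of the satisfaction conditions; $\mathcal{A}\models_{\mathbb{X}}\phi\mathbin{\dot\vee}\psi$ iff $\mathcal{A}\models_{\mathbb{X}}\phi$ or $\mathcal{A}\models_{\mathbb{X}}\psi$; $\mathcal{A}\models_{\mathbb{X}}\exists^1x\phi$ iff $\mathcal{A}\models_{\mathbb{X}(a/x)}\phi$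 for some $a\in A$; $\mathcal{A}\models_{\mathbb{X}}\forall^1x\phi$ iff $\mathcal{A}\models_{\mathbb{X}(a/x)}\phi$ for all $a\in A$. -}

module Defs where

open import Level using (0ℓ)
open import Data.Nat as ℕ using (ℕ; suc)
open import Data.Bool using (Bool; true; false; if_then_else_; _∧_; not)
open import Data.Fin using (Fin)
open import Data.List using (List; []; _∷_; length; map; concatMap; foldr; filter)
open import Data.Vec using (Vec; []; _∷_; lookup; _[_]≔_)
import Data.Vec.Properties as VecP
import Data.Fin.Properties as FinP
open import Data.List.Membership.DecPropositional ℕ._≟_ using (_∈?_)
open import Data.List.Membership.Propositional using (_∈_)
open import Data.List.Relation.Unary.Any using (index)
open import Data.List.Relation.Unary.All using (All)
open import Data.Product using (Σ; _×_)
open import Data.Sum using (_⊎_)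
open import Relation.Nullary using (¬_; yes; no)
open import Relation.Nullary.Decidable using (⌊_⌋)
open import Relation.Binary.PropositionalEquality using (_≡_; _≢_)
open import Relation.Binary.Structures using (IsTotalOrder)
import Algebra.Structures as AS

-- Weights: an ordered field (the paper uses ℝ, which is an instance).
-- _⁻¹ is total; only its value on nonzero elements is constrained.

record OrderedField : Set₁ where
  infixl 6 _+_
  infixl 7 _*_
  infix 4 _≤_
  field
    Carrier : Set
    _+_ _*_ : Carrier → Carrier → Carrier
    -_ : Carrier → Carrier
    0# 1# : Carrier
    _⁻¹ : Carrier → Carrier
    _≤_ : Carrier → Carrier → Set
    isCommutativeRing : AS.IsCommutativeRing _≡_ _+_ _*_ -_ 0# 1#
    ⁻¹-inverse : ∀ x → x ≢ 0# → x * (x ⁻¹) ≡ 1#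
    0≢1 : 0# ≢ 1#
    isTotalOrder : IsTotalOrder _≡_ _≤_
    +-monoˡ-≤ : ∀ {x y} z → x ≤ y → x + z ≤ y + z
    *-nonneg : ∀ {x y} → 0# ≤ x → 0# ≤ y → 0# ≤ x * y

-- Finite vocabulary of relation and constant symbols (equality is built in
-- as an atomic formula).

record Vocabulary : Set where
  field
    nRel   : ℕ
    arity  : Fin nRel → ℕ
    nConst : ℕ

record Structure (τ : Vocabulary) : Set where
  open Vocabulary τ
  field
    size  : ℕ
    relI  : (R : Fin nRel) → Vec (Fin (suc size)) (arity R) → Bool
    const : Fin nConst → Fin (suc size)

Var : Set
Var = ℕ

module Syntax (τ : Vocabulary) where
  open Vocabulary τ

  data Term : Set where
    var : Var → Term
    con : Fin nConst → Term

  data QF : Set where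
    eq   : Term → Term → QF
    rel  : (R : Fin nRel) → Vec Term (arity R) → QF
    neg  : QF → QF
    conj : QF → QF → QF

  data Formula : Set where
    qf    : QF → Formula
    le    : QF → QF → Formula
    indep : QF → QF → QF → Formula         -- indep δ₁ δ₀ δ₂ is δ₁ ⊥⊥_{δ₀} δ₂
    ∼     : Formula → Formula              -- Boolean negation
    and   : Formula → Formula → Formula
    or    : Formula → Formula → Formula    -- Boolean disjunction
    ex1   : Var → Formula → Formula
    all1  : Var → Formula → Formula

  fvT : Term → List Var
  fvT (var x) = x ∷ []
  fvT (con _) = []

  fvTs : ∀ {n} → Vec Term n → List Var
  fvTs [] = []
  fvTs (t ∷ ts) = Data.List._++_ (fvT t) (fvTs ts)

  fvQ : QF → List Var
  fvQ (eq t u) = Data.List._++_ (fvT t) (fvT u)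
  fvQ (rel R ts) = fvTs ts
  fvQ (neg δ) = fvQ δ
  fvQ (conj δ ε) = Data.List._++_ (fvQ δ) (fvQ ε)

  remove : Var → List Var → List Var
  remove x = filter (λ y → Relation.Nullary.Decidable.¬? (x ℕ.≟ y))

  fv : Formula → List Var
  fv (qf δ) = fvQ δ
  fv (le δ ε) = Data.List._++_ (fvQ δ) (fvQ ε)
  fv (indep a b c) = Data.List._++_ (fvQ a) (Data.List._++_ (fvQ b) (fvQ c))
  fv (∼ φ) = fv φ
  fv (and φ ψ) = Data.List._++_ (fv φ) (fv ψ)
  fv (or φ ψ) = Data.List._++_ (fv φ) (fv ψ)
  fv (ex1 x φ) = remove x (fv φ)
  fv (all1 x φ) = remove x (fv φ)

-- Semantics.  A finite set D of variables is a duplicate-free list; an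
-- assignment s : D → A is a vector indexed by positions of D.

module Semantics (F : OrderedField) (τ : Vocabulary) (𝒜 : Structure τ) where
  open OrderedField F
  open Vocabulary τ
  open Structure 𝒜
  open Syntax τ

  A : Set
  A = Fin (suc size)

  record Assign (D : List Var) : Set where
    constructor asg
    field vec : Vec A (length D)
  open Assign public

  allA : ∀ {n} → List (Fin n)
  allA = Data.List.allFin _

  allVecs : (k : ℕ) → List (Vec A k)
  allVecs ℕ.zero = [] ∷ []
  allVecs (suc k) = concatMap (λ a → map (a ∷_) (allVecs k)) allA

  sumL : List Carrier → Carrier
  sumL = foldr _+_ 0#

  -- probabilistic team over D (nonnegativity is a separate hypothesis)
  Team : List Var → Set
  Team D = Assign D → Carrier

  Σ[X] : ∀ {D} → Team D → Carrier
  Σ[X] {D} X = sumL (map (λ v → X (asg v)) (allVecs (length D)))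

  distr : ∀ {D} → Team D → Team D
  distr X s = X s * (Σ[X] X ⁻¹)

  -- value of a variable (default element if not in D; irrelevant when fv ⊆ D)
  valVar : ∀ {D} → Assign D → Var → A
  valVar {D} s x with x ∈? D
  ... | yes p = lookup (vec s) (index p)
  ... | no _  = Data.Fin.zero

  valT : ∀ {D} → Assign D → Term → A
  valT s (var x) = valVar s x
  valT s (con c) = const c

  valTs : ∀ {D n} → Assign D → Vec Term n → Vec A n
  valTs s [] = []
  valTs s (t ∷ ts) = valT s t ∷ valTs s ts

  holds : ∀ {D} → Assign D → QF → Bool
  holds s (eq t u) = ⌊ valT s t FinP.≟ valT s u ⌋
  holds s (rel R ts) = relI R (valTs s ts)
  holds s (neg δ) = not (holds s δ)
  holds s (conj δ ε) = holds s δ ∧ holds s ε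

  mass : ∀ {D} → Team D → QF → Carrier
  mass {D} X δ = sumL (map (λ v → if holds (asg {D} v) δ then X (asg v) else 0#) (allVecs (length D)))

  ext : Var → List Var → List Var
  ext x D with x ∈? D
  ... | yes _ = D
  ... | no _  = x ∷ D

  upd : ∀ {D} → Assign D → (x : Var) → A → Assign (ext x D)
  upd {D} t x a with x ∈? D
  ... | yes p = asg (vec t [ index p ]≔ a)
  ... | no _  = asg (a ∷ vec t)

  -- X(a/x)(s) = Σ_{t ∈ X, t(a/x) = s} X(t)
  _⟨_/_⟩ : ∀ {D} → Team D → A → (x : Var) → Team (ext x D)
  _⟨_/_⟩ {D} X a x s =
    sumL (map (λ v → if ⌊ VecP.≡-dec FinP._≟_ (vec (upd (asg {D} v) x a)) (vec s) ⌋ then X (asg v) else 0#)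
              (allVecs (length D)))

  sat : (D : List Var) → Team D → Formula → Set
  sat D X (qf δ) = ∀ s → X s ≢ 0# → holds s δ ≡ true
  sat D X (le δ₀ δ₁) = mass X δ₀ ≤ mass X δ₁
  sat D X (indep δ₁ δ₀ δ₂) =
    mass X (conj δ₀ δ₁) * mass X (conj δ₀ δ₂) ≡ mass X δ₀ * mass X (conj (conj δ₀ δ₁) δ₂)
  sat D X (∼ φ) = (¬ sat D X φ) ⊎ (∀ s → X s ≡ 0#)
  sat D X (and φ ψ) = sat D X φ × sat D X ψ
  sat D X (or φ ψ) = sat D X φ ⊎ sat D X ψ
  sat D X (ex1 x φ) = Σ A (λ a → sat (ext x D) (X ⟨ a / x ⟩) φ)
  sat D X (all1 x φ) = ∀ a → sat (ext x D) (X ⟨ a / x ⟩) φ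

-- Every atom of the logic is invariant under rescaling a team by a positive
-- constant c: the support does not change, every mass X[δ] is multiplied by c,
-- so comparisons δ₀ ≤ δ₁ are preserved, and both sides of the independence
-- equation are multiplied by c².  Rescaling also commutes with the
-- substitutions X(a/x), so invariance propagates through all connectives and
-- quantifiers.  Finally distr X is the rescaling of X by (Σ X)⁻¹, which is
-- positive because X is nonnegative with nonempty support.
module Submission where

open import Defs
open import Data.List using (List; []; _∷_; map; length)
open import Data.List.Relation.Unary.All using (All)
open import Data.List.Relation.Unary.Unique.Propositional using (Unique)
open import Data.List.Membership.Propositional using (_∈_)
open import Data.Product using (Σ; _×_; _,_; proj₁; proj₂)
open import Function.Bundles using (_⇔_; mk⇔; Equivalence)
open import Relation.Binary.PropositionalEquality
  using (_≢_; _≡_; refl; sym; trans; cong; cong₂; subst; subst₂; module ≡-Reasoning)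
open import Level using (0ℓ)
open import Data.Bool using (true; false; if_then_else_)
open import Data.Empty using (⊥-elim)
open import Data.List.Relation.Unary.Any using (here; there)
import Data.List.Relation.Unary.Any as Any
open import Data.List.Membership.Propositional.Properties using (∈-map⁺; ∈-concatMap⁺; ∈-allFin)
open import Data.Nat using (zero; suc)
open import Data.Product.Function.NonDependent.Propositional using (_×-⇔_)
open import Data.Sum using (inj₁; inj₂)
open import Data.Sum.Function.Propositional using (_⊎-⇔_)
open import Data.Vec using (Vec; []; _∷_)
open import Function.Construct.Identity using (⇔-id)
open import Function.Related.TypeIsomorphisms using (¬-cong-⇔; →-cong-⇔)
open import Relation.Binary.Structures using (IsTotalOrder)
open import Algebra.Bundles using (CommutativeRing)
import Algebra.Structures as AS
import Algebra.Properties.Ring as RingProperties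
import Algebra.Properties.Group as GroupProperties
import Algebra.Properties.CommutativeSemigroup as CommutativeSemigroupProperties

∀-⇔ : {A : Set} {P Q : A → Set} → (∀ a → P a ⇔ Q a) → (∀ a → P a) ⇔ (∀ a → Q a)
∀-⇔ P⇔Q = mk⇔ (λ p a → Equivalence.to (P⇔Q a) (p a)) (λ q a → Equivalence.from (P⇔Q a) (q a))

∃-⇔ : {A : Set} {P Q : A → Set} → (∀ a → P a ⇔ Q a) → Σ A P ⇔ Σ A Q
∃-⇔ P⇔Q = mk⇔ (λ (a , p) → a , Equivalence.to (P⇔Q a) p) (λ (a , q) → a , Equivalence.from (P⇔Q a) q)

module OrderedFieldProperties (F : OrderedField) where
  open OrderedField F
  open AS.IsCommutativeRing isCommutativeRing
    using (+-comm; +-identityˡ; -‿inverseʳ; *-comm; *-assoc; *-identityʳ; zeroˡ; zeroʳ)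
  open IsTotalOrder isTotalOrder using (total; antisym)

  commutativeRing : CommutativeRing 0ℓ 0ℓ
  commutativeRing = record { isCommutativeRing = isCommutativeRing }

  open RingProperties (CommutativeRing.ring commutativeRing) using (-1*x≈-x; [y-z]x≈yx-zx)
  open GroupProperties (CommutativeRing.+-group commutativeRing) using (⁻¹-involutive; //-rightDividesˡ)
  open CommutativeSemigroupProperties (CommutativeRing.*-commutativeSemigroup commutativeRing)
    using (interchange)

  Positive : Carrier → Set
  Positive c = 0# ≤ c × c ≢ 0#

  x≤y⇒0≤y-x : ∀ {x y} → x ≤ y → 0# ≤ y + - x
  x≤y⇒0≤y-x {x} {y} x≤y = subst (_≤ y + - x) (-‿inverseʳ x) (+-monoˡ-≤ (- x) x≤y)

  0≤y-x⇒x≤y : ∀ {x y} → 0# ≤ y + - x → x ≤ y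
  0≤y-x⇒x≤y {x} {y} h = subst₂ _≤_ (+-identityˡ x) (//-rightDividesˡ x y) (+-monoˡ-≤ x h)

  x≤x+y : ∀ {x y} → 0# ≤ y → x ≤ x + y
  x≤x+y {x} {y} 0≤y = subst₂ _≤_ (+-identityˡ x) (+-comm y x) (+-monoˡ-≤ x 0≤y)

  y≤x+y : ∀ {x y} → 0# ≤ x → y ≤ x + y
  y≤x+y {x} {y} 0≤x = subst (_≤ x + y) (+-identityˡ y) (+-monoˡ-≤ y 0≤x)

  *-monoˡ-≤-nonNeg : ∀ {c x y} → 0# ≤ c → x ≤ y → x * c ≤ y * c
  *-monoˡ-≤-nonNeg {c} {x} {y} 0≤c x≤y =
    0≤y-x⇒x≤y (subst (0# ≤_) ([y-z]x≈yx-zx c y x) (*-nonneg (x≤y⇒0≤y-x x≤y) 0≤c))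

  0≤1 : 0# ≤ 1#
  0≤1 with total 0# 1#
  ... | inj₁ 0≤1 = 0≤1
  ... | inj₂ 1≤0 = subst (0# ≤_) -1*-1≡1 (*-nonneg 0≤-1 0≤-1)
    where
    0≤-1 : 0# ≤ - 1#
    0≤-1 = subst (0# ≤_) (+-identityˡ (- 1#)) (x≤y⇒0≤y-x 1≤0)
    -1*-1≡1 : - 1# * - 1# ≡ 1#
    -1*-1≡1 = trans (-1*x≈-x (- 1#)) (⁻¹-involutive 1#)

  ⁻¹-positive : ∀ {x} → Positive x → Positive (x ⁻¹)
  ⁻¹-positive {x} (0≤x , x≢0) = 0≤x⁻¹ , x⁻¹≢0
    where
    x*x⁻¹≡1 = ⁻¹-inverse x x≢0
    0≤x⁻¹ : 0# ≤ x ⁻¹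
    0≤x⁻¹ with total 0# (x ⁻¹)
    ... | inj₁ 0≤x⁻¹ = 0≤x⁻¹
    ... | inj₂ x⁻¹≤0 = ⊥-elim (0≢1 (antisym 0≤1 1≤0))
      where
      1≤0 : 1# ≤ 0#
      1≤0 = subst₂ _≤_ (trans (*-comm (x ⁻¹) x) x*x⁻¹≡1) (zeroˡ x) (*-monoˡ-≤-nonNeg 0≤x x⁻¹≤0)
    x⁻¹≢0 : x ⁻¹ ≢ 0#
    x⁻¹≢0 x⁻¹≡0 = 0≢1 (trans (sym (zeroʳ x)) (trans (cong (x *_) (sym x⁻¹≡0)) x*x⁻¹≡1))

  *-⁻¹-cancelʳ : ∀ {c} → c ≢ 0# → ∀ x → x * c * c ⁻¹ ≡ x
  *-⁻¹-cancelʳ {c} c≢0 x = begin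
    x * c * c ⁻¹   ≡⟨ *-assoc x c (c ⁻¹) ⟩
    x * (c * c ⁻¹) ≡⟨ cong (x *_) (⁻¹-inverse c c≢0) ⟩
    x * 1#         ≡⟨ *-identityʳ x ⟩
    x              ∎
    where open ≡-Reasoning

  *ʳ-≡⇔ : ∀ {c x y} → c ≢ 0# → (x * c ≡ y * c) ⇔ (x ≡ y)
  *ʳ-≡⇔ {c} {x} {y} c≢0 = mk⇔
    (λ xc≡yc → trans (sym (*-⁻¹-cancelʳ c≢0 x)) (trans (cong (_* c ⁻¹) xc≡yc) (*-⁻¹-cancelʳ c≢0 y)))
    (cong (_* c))

  *ʳ-≡0⇔ : ∀ {c x} → c ≢ 0# → (x * c ≡ 0#) ⇔ (x ≡ 0#)
  *ʳ-≡0⇔ {c} {x} c≢0 = subst (λ z → (x * c ≡ z) ⇔ (x ≡ 0#)) (zeroˡ c) (*ʳ-≡⇔ c≢0)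

  *ʳ-≤⇔ : ∀ {c x y} → Positive c → (x * c ≤ y * c) ⇔ (x ≤ y)
  *ʳ-≤⇔ {c} {x} {y} c>0@(0≤c , c≢0) = mk⇔
    (λ xc≤yc → subst₂ _≤_ (*-⁻¹-cancelʳ c≢0 x) (*-⁻¹-cancelʳ c≢0 y)
                 (*-monoˡ-≤-nonNeg (proj₁ (⁻¹-positive c>0)) xc≤yc))
    (*-monoˡ-≤-nonNeg 0≤c)

  *ʳ-products-≡⇔ : ∀ {c a b d e} → c ≢ 0# → ((a * c) * (b * c) ≡ (d * c) * (e * c)) ⇔ (a * b ≡ d * e)
  *ʳ-products-≡⇔ {c} {a} {b} {d} {e} c≢0 =
    subst₂ (λ u v → (u ≡ v) ⇔ (a * b ≡ d * e)) (sym (interchange a c b c)) (sym (interchange d c e c))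
      (*ʳ-≡⇔ c*c≢0)
    where
    c*c≢0 : c * c ≢ 0#
    c*c≢0 c*c≡0 = c≢0 (Equivalence.to (*ʳ-≡0⇔ c≢0) c*c≡0)

module TeamProperties (F : OrderedField) (τ : Vocabulary) (𝒜 : Structure τ) where
  open OrderedField F
  open AS.IsCommutativeRing isCommutativeRing using (distribʳ; zeroˡ)
  open IsTotalOrder isTotalOrder using (antisym) renaming (trans to ≤-trans)
  open OrderedFieldProperties F
  open Semantics F τ 𝒜
  open Syntax τ

  sumL-map-*ʳ : ∀ {B : Set} {f g : B → Carrier} {c} → (∀ b → g b ≡ f b * c) →
                ∀ l → sumL (map g l) ≡ sumL (map f l) * c
  sumL-map-*ʳ {c = c} g≡fc [] = sym (zeroˡ c)
  sumL-map-*ʳ {f = f} {g} {c} g≡fc (b ∷ l) = begin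
    g b + sumL (map g l)         ≡⟨ cong₂ _+_ (g≡fc b) (sumL-map-*ʳ g≡fc l) ⟩
    f b * c + sumL (map f l) * c ≡⟨ sym (distribʳ c (f b) _) ⟩
    (f b + sumL (map f l)) * c   ∎
    where open ≡-Reasoning

  sumL-map-nonNeg : ∀ {B : Set} {f : B → Carrier} → (∀ b → 0# ≤ f b) → ∀ l → 0# ≤ sumL (map f l)
  sumL-map-nonNeg f≥0 [] = IsTotalOrder.refl isTotalOrder
  sumL-map-nonNeg f≥0 (b ∷ l) = ≤-trans (f≥0 b) (x≤x+y (sumL-map-nonNeg f≥0 l))

  ∈⇒≤sumL-map : ∀ {B : Set} {f : B → Carrier} → (∀ b → 0# ≤ f b) →
                ∀ {b l} → b ∈ l → f b ≤ sumL (map f l)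
  ∈⇒≤sumL-map f≥0 {l = _ ∷ l} (here refl) = x≤x+y (sumL-map-nonNeg f≥0 l)
  ∈⇒≤sumL-map f≥0 {l = b′ ∷ _} (there b∈l) = ≤-trans (∈⇒≤sumL-map f≥0 b∈l) (y≤x+y (f≥0 b′))

  ∈-allVecs : ∀ k (v : Vec A k) → v ∈ allVecs k
  ∈-allVecs zero [] = here refl
  ∈-allVecs (suc k) (a ∷ v) =
    ∈-concatMap⁺ (λ b → map (b ∷_) (allVecs k))
      (Any.map (λ { refl → ∈-map⁺ (a ∷_) (∈-allVecs k v) }) (∈-allFin a))

  Σ[X]-positive : ∀ {D} (X : Team D) → (∀ s → 0# ≤ X s) → Σ (Assign D) (λ s → X s ≢ 0#) →
                  Positive (Σ[X] X)
  Σ[X]-positive {D} X X≥0 (s , Xs≢0) =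
    sumL-map-nonNeg X≥0′ (allVecs (length D)) ,
    λ Σ≡0 → Xs≢0 (antisym (subst (X s ≤_) Σ≡0 Xs≤Σ) (X≥0 s))
    where
    X≥0′ = λ v → X≥0 (asg v)
    Xs≤Σ = ∈⇒≤sumL-map X≥0′ (∈-allVecs _ (vec s))

  Scaled : ∀ {D} → Carrier → Team D → Team D → Set
  Scaled c X Y = ∀ s → Y s ≡ X s * c

  if-scaled : ∀ b {c x y} → y ≡ x * c → (if b then y else 0#) ≡ (if b then x else 0#) * c
  if-scaled true  y≡xc = y≡xc
  if-scaled false {c} _ = sym (zeroˡ c)

  mass-scaled : ∀ {D c} {X Y : Team D} → Scaled c X Y → ∀ δ → mass Y δ ≡ mass X δ * c
  mass-scaled {D} Y≡Xc δ =
    sumL-map-*ʳ (λ v → if-scaled (holds (asg {D} v) δ) (Y≡Xc (asg v))) (allVecs (length D))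

  ⟨/⟩-scaled : ∀ {D c} {X Y : Team D} → Scaled c X Y → ∀ a x → Scaled c (X ⟨ a / x ⟩) (Y ⟨ a / x ⟩)
  ⟨/⟩-scaled {D} Y≡Xc a x s = sumL-map-*ʳ (λ v → if-scaled _ (Y≡Xc (asg v))) (allVecs (length D))

  module _ {c} (c>0 : Positive c) where

    scaled-≡0⇔ : ∀ {D} {X Y : Team D} → Scaled c X Y → ∀ s → (Y s ≡ 0#) ⇔ (X s ≡ 0#)
    scaled-≡0⇔ Y≡Xc s = subst (λ y → (y ≡ 0#) ⇔ _) (sym (Y≡Xc s)) (*ʳ-≡0⇔ (proj₂ c>0))

    sat-scaled : ∀ {D} {X Y : Team D} → Scaled c X Y → ∀ φ → sat D Y φ ⇔ sat D X φ
    sat-scaled Y≡Xc (qf δ) = ∀-⇔ λ s → →-cong-⇔ (¬-cong-⇔ (scaled-≡0⇔ Y≡Xc s)) (⇔-id _)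
    sat-scaled Y≡Xc (le δ₀ δ₁)
      rewrite mass-scaled Y≡Xc δ₀ | mass-scaled Y≡Xc δ₁ = *ʳ-≤⇔ c>0
    sat-scaled Y≡Xc (indep δ₁ δ₀ δ₂)
      rewrite mass-scaled Y≡Xc (conj δ₀ δ₁) | mass-scaled Y≡Xc (conj δ₀ δ₂)
            | mass-scaled Y≡Xc δ₀ | mass-scaled Y≡Xc (conj (conj δ₀ δ₁) δ₂) = *ʳ-products-≡⇔ (proj₂ c>0)
    sat-scaled Y≡Xc (∼ φ) = ¬-cong-⇔ (sat-scaled Y≡Xc φ) ⊎-⇔ ∀-⇔ (scaled-≡0⇔ Y≡Xc)
    sat-scaled Y≡Xc (and φ ψ) = sat-scaled Y≡Xc φ ×-⇔ sat-scaled Y≡Xc ψ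
    sat-scaled Y≡Xc (or φ ψ) = sat-scaled Y≡Xc φ ⊎-⇔ sat-scaled Y≡Xc ψ
    sat-scaled Y≡Xc (ex1 x φ) = ∃-⇔ λ a → sat-scaled (⟨/⟩-scaled Y≡Xc a x) φ
    sat-scaled Y≡Xc (all1 x φ) = ∀-⇔ λ a → sat-scaled (⟨/⟩-scaled Y≡Xc a x) φ

proposition1 : (F : OrderedField) (τ : Vocabulary) (𝒜 : Structure τ)
    (D : List Var) → Unique D →
    (X : Semantics.Team F τ 𝒜 D) →
    (∀ s → OrderedField._≤_ F (OrderedField.0# F) (X s)) →
    Σ (Semantics.Assign F τ 𝒜 D) (λ s → X s ≢ OrderedField.0# F) →
    (φ : Syntax.Formula τ) → All (_∈ D) (Syntax.fv τ φ) →
    Semantics.sat F τ 𝒜 D (Semantics.distr F τ 𝒜 X) φ ⇔ Semantics.sat F τ 𝒜 D X φ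
proposition1 F τ 𝒜 D _ X X≥0 X≢0 φ _ =
  sat-scaled (⁻¹-positive (Σ[X]-positive X X≥0 X≢0)) (λ _ → refl) φ
  where
  open OrderedFieldProperties F
  open TeamProperties F τ 𝒜
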